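{- Let $T$ be a MinD tree with $n\ge 4$ leaves and let $c_T(n)$ be its Colless index. Then $$N(c_T(n))<\frac{2\lfloor\log_2(n)\rfloor}{n}.$$
   Context: A full binary tree is a rooted tree in which every node has $0$ or $2$ children. An internal node is a $D$-node if its two children have different numbers of descendant leaves. A MinD tree on $n$ leaves is a full binary tree with $n$ leaves having the minimum number of $D$-nodes among all full binary trees with $n$ leaves. The Colless index of a full binary tree is $\sum|\ell_L(v)-\ell_R(v)|$ over internal nodes $v$, where $\ell_L(v),\ell_R(v)$ are the numbers of leaves of the left and right subtrees of $v$. Let $\delta(n)$ and $c_{max}(n)$ be, respectively, the minimum and maximum Colless index over all full binary trees with $n$ leaves (for $n\ge4$ these differ). The normalized Colless index of a tree with $n$ leaves and Colless index $c$ is $N(c)=\dfrac{c-\delta(n)}{c_{max}(n)-\delta(n)}$. -}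

module Defs where

open import Data.Nat using (ℕ; zero; suc; _+_; _*_; _∸_; _≤_; _<_; ∣_-_∣)
open import Data.Nat.Logarithm using (⌊log₂_⌋)
open import Data.Product using (Σ; _×_)
open import Relation.Binary.PropositionalEquality using (_≡_)

data Tree : Set where
  leaf : Tree
  node : Tree → Tree → Tree

leaves : Tree → ℕ
leaves leaf       = 1
leaves (node l r) = leaves l + leaves r

diff? : ℕ → ℕ → ℕ
diff? zero    zero    = 0
diff? zero    (suc _) = 1
diff? (suc _) zero    = 1
diff? (suc m) (suc n) = diff? m n

dNodes : Tree → ℕ
dNodes leaf       = 0
dNodes (node l r) = diff? (leaves l) (leaves r) + dNodes l + dNodes r

colless : Tree → ℕ
colless leaf       = 0
colless (node l r) = ∣ leaves l - leaves r ∣ + colless l + colless r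

IsMinD : ℕ → Tree → Set
IsMinD n T = leaves T ≡ n × (∀ (T' : Tree) → leaves T' ≡ n → dNodes T ≤ dNodes T')

IsMinColless : ℕ → ℕ → Set
IsMinColless n d =
  Σ Tree (λ T → leaves T ≡ n × colless T ≡ d) × (∀ (T : Tree) → leaves T ≡ n → d ≤ colless T)

IsMaxColless : ℕ → ℕ → Set
IsMaxColless n m =
  Σ Tree (λ T → leaves T ≡ n × colless T ≡ m) × (∀ (T : Tree) → leaves T ≡ n → colless T ≤ m)

-- N(c) < 2⌊log₂ n⌋ / n, cross-multiplied by the positive denominators
-- (c_max - δ) > 0 and n > 0:  (c - δ) * n < 2⌊log₂ n⌋ * (c_max - δ).
NormCollessBelow : ℕ → ℕ → ℕ → ℕ → Set
NormCollessBelow n c δ cmax = (c ∸ δ) * n < 2 * ⌊log₂ n ⌋ * (cmax ∸ δ)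

-- A MinD tree has at most as many D-nodes as the tree read off the binary
-- expansion of n, which has one D-node per digit 1 below the leading one; so
-- d = dNodes T and L = ⌊log₂ n⌋ satisfy 2^d + 2^L ≤ n + 1.  By induction on
-- trees, c + 2n ≤ d·n + 2·2^L for every tree: at a balanced node the bounds of
-- the children add up, at an unbalanced node the imbalance is paid for by the
-- extra D-node.  If d < L this gives c ≤ d(n − 2), hence c·n < L(n − 1)(n − 2);
-- otherwise n = 2^(L+1) − 1 and d = L, and the same follows from 3L + 1 ≤ n.
-- Since (n − 1)(n − 2)/2 is the Colless index of the caterpillar, c·n < 2L·c_max,
-- and subtracting δ from c and c_max preserves this because 2L ≤ n.

module Submission where

open import Defs
open import Data.Nat
open import Data.Nat.Properties
open import Data.Nat.Logarithm
open import Data.Nat.Tactic.RingSolver using (solve)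
open import Data.List using (_∷_; [])
open import Algebra.Properties.CommutativeSemigroup +-commutativeSemigroup using (xy∙z≈xz∙y)
open import Data.Product using (_×_; _,_; ∃-syntax; proj₁; proj₂)
open import Data.Sum using (inj₁; inj₂)
open import Function using (_∘_)
open import Relation.Binary.PropositionalEquality
open import Relation.Nullary using (yes; no)
open import Relation.Nullary.Negation using (contradiction)

data Bin⁺ : Set where
  1ᵇ    : Bin⁺
  2×_   : Bin⁺ → Bin⁺
  1+2×_ : Bin⁺ → Bin⁺

toℕ : Bin⁺ → ℕ
toℕ 1ᵇ        = 1
toℕ (2× x)    = 2 * toℕ x
toℕ (1+2× x)  = suc (2 * toℕ x)

toℕ-nonZero : ∀ x → NonZero (toℕ x)
toℕ-nonZero 1ᵇ       = _
toℕ-nonZero (2× x)   = m*n≢0 2 (toℕ x) {{_}} {{toℕ-nonZero x}}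
toℕ-nonZero (1+2× x) = _

successor : Bin⁺ → Bin⁺
successor 1ᵇ       = 2× 1ᵇ
successor (2× x)   = 1+2× x
successor (1+2× x) = 2× successor x

toℕ-successor : ∀ x → toℕ (successor x) ≡ suc (toℕ x)
toℕ-successor 1ᵇ       = refl
toℕ-successor (2× x)   = refl
toℕ-successor (1+2× x) = begin
  2 * toℕ (successor x) ≡⟨ cong (2 *_) (toℕ-successor x) ⟩
  2 * suc (toℕ x)       ≡⟨ *-suc 2 (toℕ x) ⟩
  2 + 2 * toℕ x         ∎
  where open ≡-Reasoning

fromSuc : ℕ → Bin⁺
fromSuc zero    = 1ᵇ
fromSuc (suc n) = successor (fromSuc n)

toℕ-fromSuc : ∀ n → toℕ (fromSuc n) ≡ suc n
toℕ-fromSuc zero    = refl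
toℕ-fromSuc (suc n) = trans (toℕ-successor (fromSuc n)) (cong suc (toℕ-fromSuc n))

⌊1+2n/2⌋≡n : ∀ n → ⌊ suc (2 * n) /2⌋ ≡ n
⌊1+2n/2⌋≡n zero    = refl
⌊1+2n/2⌋≡n (suc n) = begin
  ⌊ suc (2 * suc n) /2⌋ ≡⟨ cong (λ k → ⌊ suc k /2⌋) (*-suc 2 n) ⟩
  suc ⌊ suc (2 * n) /2⌋ ≡⟨ cong suc (⌊1+2n/2⌋≡n n) ⟩
  suc n                 ∎
  where open ≡-Reasoning

⌊log₂[1+2n]⌋≡1+⌊log₂n⌋ : ∀ n .{{_ : NonZero n}} → ⌊log₂ suc (2 * n) ⌋ ≡ suc ⌊log₂ n ⌋
⌊log₂[1+2n]⌋≡1+⌊log₂n⌋ n = begin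
  ⌊log₂ suc (2 * n) ⌋               ≡⟨ suc-pred _ ⟨
  suc (⌊log₂ suc (2 * n) ⌋ ∸ 1)     ≡⟨ cong suc (⌊log₂⌊n/2⌋⌋≡⌊log₂n⌋∸1 (suc (2 * n))) ⟨
  suc ⌊log₂ ⌊ suc (2 * n) /2⌋ ⌋     ≡⟨ cong (λ k → suc ⌊log₂ k ⌋) (⌊1+2n/2⌋≡n n) ⟩
  suc ⌊log₂ n ⌋                     ∎
  where
  open ≡-Reasoning
  instance
    log-nonZero : NonZero ⌊log₂ suc (2 * n) ⌋
    log-nonZero = >-nonZero (≤-trans (s≤s z≤n)
      (≤-trans (≤-reflexive (sym (⌊log₂[2*b]⌋≡1+⌊log₂b⌋ n))) (⌊log₂⌋-mono-≤ (n≤1+n (2 * n)))))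

2^⌊log₂⌋-bounds : ∀ x → 2 ^ ⌊log₂ toℕ x ⌋ ≤ toℕ x × toℕ x < 2 ^ suc ⌊log₂ toℕ x ⌋
2^⌊log₂⌋-bounds 1ᵇ = s≤s z≤n , s≤s (s≤s z≤n)
2^⌊log₂⌋-bounds (2× x) rewrite ⌊log₂[2*b]⌋≡1+⌊log₂b⌋ (toℕ x) {{toℕ-nonZero x}} =
  let lower , upper = 2^⌊log₂⌋-bounds x in *-monoʳ-≤ 2 lower , *-monoʳ-< 2 upper
2^⌊log₂⌋-bounds (1+2× x) rewrite ⌊log₂[1+2n]⌋≡1+⌊log₂n⌋ (toℕ x) {{toℕ-nonZero x}} =
  let lower , upper = 2^⌊log₂⌋-bounds x
  in m≤n⇒m≤1+n (*-monoʳ-≤ 2 lower) , ≤-trans (≤-reflexive (sym (*-suc 2 (toℕ x)))) (*-monoʳ-≤ 2 upper)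

2^⌊log₂n⌋≤n : ∀ n .{{_ : NonZero n}} → 2 ^ ⌊log₂ n ⌋ ≤ n
2^⌊log₂n⌋≤n (suc n) =
  subst (λ k → 2 ^ ⌊log₂ k ⌋ ≤ k) (toℕ-fromSuc n) (proj₁ (2^⌊log₂⌋-bounds (fromSuc n)))

n<2^[1+⌊log₂n⌋] : ∀ n .{{_ : NonZero n}} → n < 2 ^ suc ⌊log₂ n ⌋
n<2^[1+⌊log₂n⌋] (suc n) =
  subst (λ k → k < 2 ^ suc ⌊log₂ k ⌋) (toℕ-fromSuc n) (proj₂ (2^⌊log₂⌋-bounds (fromSuc n)))

diff?-self : ∀ n → diff? n n ≡ 0
diff?-self zero    = refl
diff?-self (suc n) = diff?-self n

diff?-≢ : ∀ {m n} → m ≢ n → diff? m n ≡ 1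
diff?-≢ {zero}  {zero}  m≢n = contradiction refl m≢n
diff?-≢ {zero}  {suc n} _   = refl
diff?-≢ {suc m} {zero}  _   = refl
diff?-≢ {suc m} {suc n} m≢n = diff?-≢ (m≢n ∘ cong suc)

diff?-double : ∀ m n → diff? (2 * m) (2 * n) ≡ diff? m n
diff?-double zero    zero    = refl
diff?-double zero    (suc n) = refl
diff?-double (suc m) zero    = refl
diff?-double (suc m) (suc n) rewrite +-suc m (m + 0) | +-suc n (n + 0) = diff?-double m n

leaves-nonZero : ∀ t → NonZero (leaves t)
leaves-nonZero leaf       = _
leaves-nonZero (node l r) =
  >-nonZero (≤-trans (>-nonZero⁻¹ (leaves l) {{leaves-nonZero l}}) (m≤m+n (leaves l) (leaves r)))

double : Tree → Tree
double leaf       = node leaf leaf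
double (node l r) = node (double l) (double r)

leaves-double : ∀ t → leaves (double t) ≡ 2 * leaves t
leaves-double leaf       = refl
leaves-double (node l r) rewrite leaves-double l | leaves-double r = sym (*-distribˡ-+ 2 (leaves l) (leaves r))

dNodes-double : ∀ t → dNodes (double t) ≡ dNodes t
dNodes-double leaf       = refl
dNodes-double (node l r)
  rewrite leaves-double l | leaves-double r | diff?-double (leaves l) (leaves r)
        | dNodes-double l | dNodes-double r = refl

fromBin : Bin⁺ → Tree
fromBin 1ᵇ       = leaf
fromBin (2× x)   = double (fromBin x)
fromBin (1+2× x) = node (double (fromBin x)) leaf

leaves-fromBin : ∀ x → leaves (fromBin x) ≡ toℕ x
leaves-fromBin 1ᵇ       = refl
leaves-fromBin (2× x)   = trans (leaves-double (fromBin x)) (cong (2 *_) (leaves-fromBin x))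
leaves-fromBin (1+2× x) =
  trans (cong (_+ 1) (trans (leaves-double (fromBin x)) (cong (2 *_) (leaves-fromBin x)))) (+-comm (2 * toℕ x) 1)

dNodes-fromBin-1+2× : ∀ x → dNodes (fromBin (1+2× x)) ≡ suc (dNodes (fromBin x))
dNodes-fromBin-1+2× x
  rewrite leaves-double (fromBin x) | leaves-fromBin x | dNodes-double (fromBin x)
        | diff?-≢ (>⇒≢ (*-monoʳ-≤ 2 (>-nonZero⁻¹ (toℕ x) {{toℕ-nonZero x}})))
        | +-identityʳ (dNodes (fromBin x)) = refl

2^dNodes+2^⌊log₂⌋≤1+ : ∀ x → 2 ^ dNodes (fromBin x) + 2 ^ ⌊log₂ toℕ x ⌋ ≤ suc (toℕ x)
2^dNodes+2^⌊log₂⌋≤1+ 1ᵇ = ≤-refl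
2^dNodes+2^⌊log₂⌋≤1+ (2× x)
  rewrite dNodes-double (fromBin x) | ⌊log₂[2*b]⌋≡1+⌊log₂b⌋ (toℕ x) {{toℕ-nonZero x}} =
  doubling (m^n>0 2 (dNodes (fromBin x))) (2^dNodes+2^⌊log₂⌋≤1+ x)
  where
  doubling : ∀ {p q v} → 0 < p → p + q ≤ suc v → p + 2 * q ≤ suc (2 * v)
  doubling {p} {q} {v} p>0 p+q≤1+v = s≤s⁻¹ (begin
    suc (p + 2 * q)   ≤⟨ +-monoˡ-≤ (p + 2 * q) p>0 ⟩
    p + (p + 2 * q)   ≡⟨ solve (p ∷ q ∷ []) ⟩
    2 * (p + q)       ≤⟨ *-monoʳ-≤ 2 p+q≤1+v ⟩
    2 * suc v         ≡⟨ *-suc 2 v ⟩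
    suc (suc (2 * v)) ∎)
    where open ≤-Reasoning
2^dNodes+2^⌊log₂⌋≤1+ (1+2× x)
  rewrite dNodes-fromBin-1+2× x | ⌊log₂[1+2n]⌋≡1+⌊log₂n⌋ (toℕ x) {{toℕ-nonZero x}} = begin
    2 * 2 ^ d + 2 * 2 ^ L ≡⟨ *-distribˡ-+ 2 (2 ^ d) (2 ^ L) ⟨
    2 * (2 ^ d + 2 ^ L)   ≤⟨ *-monoʳ-≤ 2 (2^dNodes+2^⌊log₂⌋≤1+ x) ⟩
    2 * suc (toℕ x)       ≡⟨ *-suc 2 (toℕ x) ⟩
    suc (suc (2 * toℕ x)) ∎
  where
  open ≤-Reasoning
  d L : ℕ
  d = dNodes (fromBin x)
  L = ⌊log₂ toℕ x ⌋

sparse-tree : ∀ n .{{_ : NonZero n}} → ∃[ t ] leaves t ≡ n × 2 ^ dNodes t + 2 ^ ⌊log₂ n ⌋ ≤ suc n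
sparse-tree (suc n) = fromBin x , trans (leaves-fromBin x) x≡1+n ,
  subst (λ k → 2 ^ dNodes (fromBin x) + 2 ^ ⌊log₂ k ⌋ ≤ suc k) x≡1+n (2^dNodes+2^⌊log₂⌋≤1+ x)
  where
  x : Bin⁺
  x = fromSuc n
  x≡1+n : toℕ x ≡ suc n
  x≡1+n = toℕ-fromSuc n

minD⇒2^dNodes+2^⌊log₂⌋≤1+ : ∀ {n T} .{{_ : NonZero n}} → IsMinD n T → 2 ^ dNodes T + 2 ^ ⌊log₂ n ⌋ ≤ suc n
minD⇒2^dNodes+2^⌊log₂⌋≤1+ {n} (_ , minimal) =
  let t , leaves-t , bound = sparse-tree n
  in ≤-trans (+-monoˡ-≤ (2 ^ ⌊log₂ n ⌋) (^-monoʳ-≤ 2 (minimal t leaves-t))) bound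

-- c ≤ (d − 2)·a + 2·2^⌊log₂ a⌋, stated without truncated subtraction.
CollessBounded : ℕ → ℕ → ℕ → Set
CollessBounded c d a = c + 2 * a ≤ d * a + 2 * 2 ^ ⌊log₂ a ⌋

2^⌊log₂[n+n]⌋ : ∀ n .{{_ : NonZero n}} → 2 ^ ⌊log₂ (n + n) ⌋ ≡ 2 * 2 ^ ⌊log₂ n ⌋
2^⌊log₂[n+n]⌋ n =
  cong (2 ^_) (trans (cong (λ k → ⌊log₂ (n + k) ⌋) (sym (+-identityʳ n))) (⌊log₂[2*b]⌋≡1+⌊log₂b⌋ n))

balanced-step : ∀ {cₗ cᵣ dₗ dᵣ a P} →
  cₗ + 2 * a ≤ dₗ * a + 2 * P → cᵣ + 2 * a ≤ dᵣ * a + 2 * P →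
  0 + cₗ + cᵣ + 2 * (a + a) ≤ (0 + dₗ + dᵣ) * (a + a) + 2 * (2 * P)
balanced-step {cₗ} {cᵣ} {dₗ} {dᵣ} {a} {P} boundₗ boundᵣ = begin
  0 + cₗ + cᵣ + 2 * (a + a)                          ≡⟨ solve (cₗ ∷ cᵣ ∷ a ∷ []) ⟩
  (cₗ + 2 * a) + (cᵣ + 2 * a)                        ≤⟨ +-mono-≤ boundₗ boundᵣ ⟩
  (dₗ * a + 2 * P) + (dᵣ * a + 2 * P)                ≤⟨ m≤m+n _ ((dₗ + dᵣ) * a) ⟩
  (dₗ * a + 2 * P) + (dᵣ * a + 2 * P) + (dₗ + dᵣ) * a ≡⟨ solve (dₗ ∷ dᵣ ∷ a ∷ P ∷ []) ⟩
  (0 + dₗ + dᵣ) * (a + a) + 2 * (2 * P)              ∎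
  where open ≤-Reasoning

unbalanced-step : ∀ {cₗ cᵣ dₗ dᵣ b o Pₗ Pᵣ P} →
  cₗ + 2 * (b + o) ≤ dₗ * (b + o) + 2 * Pₗ → cᵣ + 2 * b ≤ dᵣ * b + 2 * Pᵣ → Pₗ ≤ P → Pᵣ ≤ b →
  o + cₗ + cᵣ + 2 * (b + o + b) ≤ (1 + dₗ + dᵣ) * (b + o + b) + 2 * P
unbalanced-step {cₗ} {cᵣ} {dₗ} {dᵣ} {b} {o} {Pₗ} {Pᵣ} {P} boundₗ boundᵣ Pₗ≤P Pᵣ≤b = begin
  o + cₗ + cᵣ + 2 * (b + o + b)                               ≡⟨ solve (cₗ ∷ cᵣ ∷ b ∷ o ∷ []) ⟩
  (cₗ + 2 * (b + o)) + (cᵣ + 2 * b) + o                       ≤⟨ +-monoˡ-≤ o (+-mono-≤ boundₗ boundᵣ) ⟩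
  (dₗ * (b + o) + 2 * Pₗ) + (dᵣ * b + 2 * Pᵣ) + o              ≤⟨ +-monoˡ-≤ o (+-mono-≤ 2Pₗ≤2P 2Pᵣ≤2b) ⟩
  (dₗ * (b + o) + 2 * P) + (dᵣ * b + 2 * b) + o                ≤⟨ m≤m+n _ (dₗ * b + dᵣ * (b + o)) ⟩
  (dₗ * (b + o) + 2 * P) + (dᵣ * b + 2 * b) + o + (dₗ * b + dᵣ * (b + o)) ≡⟨ solve (dₗ ∷ dᵣ ∷ b ∷ o ∷ P ∷ []) ⟩
  (1 + dₗ + dᵣ) * (b + o + b) + 2 * P                         ∎
  where
  open ≤-Reasoning
  2Pₗ≤2P : dₗ * (b + o) + 2 * Pₗ ≤ dₗ * (b + o) + 2 * P
  2Pₗ≤2P = +-monoʳ-≤ (dₗ * (b + o)) (*-monoʳ-≤ 2 Pₗ≤P)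
  2Pᵣ≤2b : dᵣ * b + 2 * Pᵣ ≤ dᵣ * b + 2 * b
  2Pᵣ≤2b = +-monoʳ-≤ (dᵣ * b) (*-monoʳ-≤ 2 Pᵣ≤b)

collessBounded-unbalanced : ∀ {cₗ cᵣ dₗ dᵣ a b} .{{_ : NonZero b}} → b ≤ a →
  CollessBounded cₗ dₗ a → CollessBounded cᵣ dᵣ b →
  CollessBounded (∣ a - b ∣ + cₗ + cᵣ) (1 + dₗ + dᵣ) (a + b)
collessBounded-unbalanced {cₗ} {cᵣ} {dₗ} {dᵣ} {b = b} b≤a boundₗ boundᵣ with m≤n⇒∃[o]m+o≡n b≤a
... | o , refl =
  subst (λ x → CollessBounded (x + cₗ + cᵣ) (1 + dₗ + dᵣ) (b + o + b))
        (sym (trans (∣-∣-comm (b + o) b) (∣m-m+n∣≡n b o)))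
        (unbalanced-step {cₗ} {cᵣ} {dₗ} {dᵣ} {b} {o} {2 ^ ⌊log₂ (b + o) ⌋} {2 ^ ⌊log₂ b ⌋} boundₗ boundᵣ
          (^-monoʳ-≤ 2 (⌊log₂⌋-mono-≤ (m≤m+n (b + o) b))) (2^⌊log₂n⌋≤n b))

collessBounded-node : ∀ {cₗ cᵣ dₗ dᵣ} a b .{{_ : NonZero a}} .{{_ : NonZero b}} →
  CollessBounded cₗ dₗ a → CollessBounded cᵣ dᵣ b →
  CollessBounded (∣ a - b ∣ + cₗ + cᵣ) (diff? a b + dₗ + dᵣ) (a + b)
collessBounded-node {cₗ} {cᵣ} {dₗ} {dᵣ} a b boundₗ boundᵣ with a ≟ b
... | yes refl =
  subst₂ (λ x P → x + cₗ + cᵣ + 2 * (a + a) ≤ (diff? a a + dₗ + dᵣ) * (a + a) + 2 * P)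
         (sym (∣n-n∣≡0 a)) (sym (2^⌊log₂[n+n]⌋ a))
         (subst (λ x → 0 + cₗ + cᵣ + 2 * (a + a) ≤ (x + dₗ + dᵣ) * (a + a) + 2 * (2 * 2 ^ ⌊log₂ a ⌋))
                (sym (diff?-self a))
                (balanced-step {cₗ} {cᵣ} {dₗ} {dᵣ} {a} {2 ^ ⌊log₂ a ⌋} boundₗ boundᵣ))
... | no a≢b rewrite diff?-≢ a≢b with ≤-total b a
...   | inj₁ b≤a = collessBounded-unbalanced {cₗ} {cᵣ} {dₗ} {dᵣ} b≤a boundₗ boundᵣ
...   | inj₂ a≤b =
  subst₂ (λ c d → CollessBounded c d (a + b))
         (trans (cong (λ x → x + cᵣ + cₗ) (∣-∣-comm b a)) (xy∙z≈xz∙y ∣ a - b ∣ cᵣ cₗ))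
         (xy∙z≈xz∙y 1 dᵣ dₗ)
         (subst (CollessBounded (∣ b - a ∣ + cᵣ + cₗ) (1 + dᵣ + dₗ)) (+-comm b a)
                (collessBounded-unbalanced {cᵣ} {cₗ} {dᵣ} {dₗ} a≤b boundᵣ boundₗ))

colless-bound : ∀ t → CollessBounded (colless t) (dNodes t) (leaves t)
colless-bound leaf       = s≤s (s≤s z≤n)
colless-bound (node l r) =
  collessBounded-node (leaves l) (leaves r) {{leaves-nonZero l}} {{leaves-nonZero r}}
    (colless-bound l) (colless-bound r)

n<2^n : ∀ n → n < 2 ^ n
n<2^n zero    = s≤s z≤n
n<2^n (suc n) = +-mono-≤ (m^n>0 2 n) (≤-trans (n<2^n n) (m≤m+n (2 ^ n) 0))

2*n≤2^n : ∀ n → 2 * n ≤ 2 ^ n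
2*n≤2^n zero    = z≤n
2*n≤2^n (suc n) = *-monoʳ-≤ 2 (n<2^n n)

3*[2+n]+2≤2^[3+n] : ∀ n → 3 * (2 + n) + 2 ≤ 2 ^ (3 + n)
3*[2+n]+2≤2^[3+n] zero    = ≤-refl
3*[2+n]+2≤2^[3+n] (suc n) = begin
  3 * (3 + n) + 2           ≡⟨ solve (n ∷ []) ⟩
  (3 * (2 + n) + 2) + 3     ≤⟨ +-mono-≤ (3*[2+n]+2≤2^[3+n] n) 3≤2^[3+n] ⟩
  2 ^ (3 + n) + 2 ^ (3 + n) ≡⟨ cong (2 ^ (3 + n) +_) (+-identityʳ (2 ^ (3 + n))) ⟨
  2 ^ (4 + n)               ∎
  where
  open ≤-Reasoning
  3≤2^[3+n] : 3 ≤ 2 ^ (3 + n)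
  3≤2^[3+n] = ≤-trans (s≤s (s≤s (s≤s z≤n))) (^-monoʳ-≤ 2 {3} {3 + n} (s≤s (s≤s (s≤s z≤n))))

c≤d*m⇒c*[2+m]<L*[m*[1+m]] : ∀ {c d L m} .{{_ : NonZero m}} → c ≤ d * m → d < L → L ≤ suc m →
  c * (2 + m) < L * (m * suc m)
c≤d*m⇒c*[2+m]<L*[m*[1+m]] {c} {d} {L} {m} c≤dm d<L L≤1+m = begin-strict
  c * (2 + m)       ≤⟨ *-monoˡ-≤ (2 + m) c≤dm ⟩
  d * m * (2 + m)   ≡⟨ solve (d ∷ m ∷ []) ⟩
  m * (d * (2 + m)) <⟨ *-monoʳ-< m d[2+m]<L[1+m] ⟩
  m * (L * suc m)   ≡⟨ solve (m ∷ L ∷ []) ⟩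
  L * (m * suc m)   ∎
  where
  open ≤-Reasoning
  d[2+m]<L[1+m] : d * (2 + m) < L * suc m
  d[2+m]<L[1+m] = begin-strict
    d * (2 + m)     ≡⟨ *-suc d (suc m) ⟩
    d + d * suc m   <⟨ +-monoˡ-< (d * suc m) (<-≤-trans d<L L≤1+m) ⟩
    suc d * suc m   ≤⟨ *-monoˡ-≤ (suc m) d<L ⟩
    L * suc m       ∎

c≤l*[2+m]+1⇒c*[2+m]<[1+l]*[m*[1+m]] : ∀ {c l m} → c ≤ l * (2 + m) + 1 → 3 * l + 2 ≤ m →
  c * (2 + m) < suc l * (m * suc m)
c≤l*[2+m]+1⇒c*[2+m]<[1+l]*[m*[1+m]] {c} {l} c≤ 3l+2≤m with m≤n⇒∃[o]m+o≡n 3l+2≤m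
... | e , refl = begin-strict
  c * (2 + (3 * l + 2 + e))                                ≤⟨ *-monoˡ-≤ (2 + (3 * l + 2 + e)) c≤ ⟩
  (l * (2 + (3 * l + 2 + e)) + 1) * (2 + (3 * l + 2 + e))  <⟨ m<m+n _ z<s ⟩
  (l * (2 + (3 * l + 2 + e)) + 1) * (2 + (3 * l + 2 + e))
    + suc (2 * l + 1 + 3 * l * e + 4 * e + e * e)          ≡⟨ solve (l ∷ e ∷ []) ⟩
  suc l * ((3 * l + 2 + e) * suc (3 * l + 2 + e))          ∎
  where open ≤-Reasoning

c+2[2+m]≤d[2+m]+2P⇒c≤d*m : ∀ {c d m P} →
  c + 2 * (2 + m) ≤ d * (2 + m) + 2 * P → d + P ≤ 2 + m → c ≤ d * m
c+2[2+m]≤d[2+m]+2P⇒c≤d*m {c} {d} {m} {P} bound d+P≤n = +-cancelʳ-≤ (2 * d + 2 * (2 + m)) c (d * m) (begin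
  c + (2 * d + 2 * (2 + m))           ≡⟨ solve (c ∷ d ∷ m ∷ []) ⟩
  (c + 2 * (2 + m)) + 2 * d           ≤⟨ +-monoˡ-≤ (2 * d) bound ⟩
  (d * (2 + m) + 2 * P) + 2 * d       ≡⟨ solve (d ∷ m ∷ P ∷ []) ⟩
  d * m + 2 * d + 2 * (d + P)         ≤⟨ +-monoʳ-≤ (d * m + 2 * d) (*-monoʳ-≤ 2 d+P≤n) ⟩
  d * m + 2 * d + 2 * (2 + m)         ≡⟨ +-assoc (d * m) (2 * d) (2 * (2 + m)) ⟩
  d * m + (2 * d + 2 * (2 + m))       ∎)
  where open ≤-Reasoning

c*[2+m]<L*[m*[1+m]]-when-2^[1+L]≡3+m : ∀ {c d L m} → 2 ≤ L → d ≤ L → 2 ^ suc L ≡ 3 + m →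
  c + 2 * (2 + m) ≤ d * (2 + m) + 2 * 2 ^ L → c * (2 + m) < L * (m * suc m)
c*[2+m]<L*[m*[1+m]]-when-2^[1+L]≡3+m {c} {d} {suc (suc k)} {m} (s≤s (s≤s _)) d≤L 2P≡3+m bound =
  c≤l*[2+m]+1⇒c*[2+m]<[1+l]*[m*[1+m]] c≤l*n+1 3l+2≤m
  where
  open ≤-Reasoning
  c≤l*n+1 : c ≤ suc k * (2 + m) + 1
  c≤l*n+1 = +-cancelʳ-≤ (2 * (2 + m)) c (suc k * (2 + m) + 1) (begin
    c + 2 * (2 + m)                        ≤⟨ bound ⟩
    d * (2 + m) + 2 * 2 ^ (2 + k)          ≤⟨ +-monoˡ-≤ _ (*-monoˡ-≤ (2 + m) d≤L) ⟩
    (2 + k) * (2 + m) + 2 ^ (3 + k)        ≡⟨ cong ((2 + k) * (2 + m) +_) 2P≡3+m ⟩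
    (2 + k) * (2 + m) + (3 + m)            ≡⟨ solve (k ∷ m ∷ []) ⟩
    suc k * (2 + m) + 1 + 2 * (2 + m)      ∎)
  3l+2≤m : 3 * suc k + 2 ≤ m
  3l+2≤m = +-cancelˡ-≤ 3 (3 * suc k + 2) m (begin
    3 + (3 * suc k + 2) ≡⟨ solve (k ∷ []) ⟩
    3 * (2 + k) + 2     ≤⟨ 3*[2+n]+2≤2^[3+n] k ⟩
    2 ^ (3 + k)         ≡⟨ 2P≡3+m ⟩
    3 + m               ∎)

c*[2+m]<L*[m*[1+m]] : ∀ {c d L m} → 2 ≤ L → 2 ^ L ≤ 2 + m → 2 + m < 2 ^ suc L →
  c + 2 * (2 + m) ≤ d * (2 + m) + 2 * 2 ^ L → 2 ^ d + 2 ^ L ≤ 3 + m → c * (2 + m) < L * (m * suc m)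
c*[2+m]<L*[m*[1+m]] {c} {d} {L} {m} 2≤L P≤n n<2P bound sparse with d <? L
... | yes d<L = c≤d*m⇒c*[2+m]<L*[m*[1+m]] {{m≢0}} c≤dm d<L L≤1+m
  where
  m≢0 : NonZero m
  m≢0 = >-nonZero (≤-trans (s≤s z≤n) (s≤s⁻¹ (s≤s⁻¹ (≤-trans (^-monoʳ-≤ 2 2≤L) P≤n))))
  c≤dm : c ≤ d * m
  c≤dm = c+2[2+m]≤d[2+m]+2P⇒c≤d*m {c} {d} {m} {2 ^ L} bound
           (s≤s⁻¹ (≤-trans (+-monoˡ-≤ (2 ^ L) (n<2^n d)) sparse))
  L≤1+m : L ≤ suc m
  L≤1+m = s≤s⁻¹ (<-≤-trans (n<2^n L) P≤n)
... | no d≮L = c*[2+m]<L*[m*[1+m]]-when-2^[1+L]≡3+m 2≤L d≤L 2P≡3+m bound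
  where
  P+P≡2P : 2 ^ L + 2 ^ L ≡ 2 ^ suc L
  P+P≡2P = cong (2 ^ L +_) (sym (+-identityʳ (2 ^ L)))
  2P≡3+m : 2 ^ suc L ≡ 3 + m
  2P≡3+m = ≤-antisym
    (≤-trans (≤-reflexive (sym P+P≡2P)) (≤-trans (+-monoˡ-≤ (2 ^ L) (^-monoʳ-≤ 2 (≮⇒≥ d≮L))) sparse))
    n<2P
  2^d≤P : 2 ^ d ≤ 2 ^ L
  2^d≤P = +-cancelʳ-≤ (2 ^ L) (2 ^ d) (2 ^ L)
            (≤-trans sparse (≤-reflexive (trans (sym 2P≡3+m) (sym P+P≡2P))))
  d≤L : d ≤ L
  d≤L = ≮⇒≥ (λ L<d → <⇒≱ (^-monoʳ-< 2 (s≤s (s≤s z≤n)) L<d) 2^d≤P)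

minD⇒colless*n<⌊log₂n⌋*[m*[1+m]] : ∀ {m T} → 2 ≤ m → IsMinD (2 + m) T →
  colless T * (2 + m) < ⌊log₂ (2 + m) ⌋ * (m * suc m)
minD⇒colless*n<⌊log₂n⌋*[m*[1+m]] {m} {T} 2≤m minD@(leaves-T , _) =
  c*[2+m]<L*[m*[1+m]] {colless T} {dNodes T} (⌊log₂⌋-mono-≤ {4} {2 + m} (s≤s (s≤s 2≤m)))
    (2^⌊log₂n⌋≤n (2 + m)) (n<2^[1+⌊log₂n⌋] (2 + m))
    (subst (CollessBounded (colless T) (dNodes T)) leaves-T (colless-bound T))
    (minD⇒2^dNodes+2^⌊log₂⌋≤1+ {2 + m} {T} minD)

caterpillar : ℕ → Tree
caterpillar zero    = leaf
caterpillar (suc k) = node (caterpillar k) leaf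

leaves-caterpillar : ∀ k → leaves (caterpillar k) ≡ suc k
leaves-caterpillar zero    = refl
leaves-caterpillar (suc k) = trans (cong (_+ 1) (leaves-caterpillar k)) (+-comm (suc k) 1)

2*colless-caterpillar : ∀ k → 2 * colless (caterpillar (suc k)) ≡ k * suc k
2*colless-caterpillar zero    = refl
2*colless-caterpillar (suc k) rewrite leaves-caterpillar (suc k) = begin
  2 * (suc k + C + 0)     ≡⟨ cong (2 *_) (+-identityʳ (suc k + C)) ⟩
  2 * (suc k + C)         ≡⟨ *-distribˡ-+ 2 (suc k) C ⟩
  2 * suc k + 2 * C       ≡⟨ cong (2 * suc k +_) (2*colless-caterpillar k) ⟩
  2 * suc k + k * suc k   ≡⟨ solve (k ∷ []) ⟩
  suc k * suc (suc k)     ∎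
  where
  open ≡-Reasoning
  C : ℕ
  C = colless (caterpillar (suc k))

a*n<k*b⇒[a∸δ]*n<k*[b∸δ] : ∀ {a b k n δ} → δ ≤ a → δ ≤ b → k ≤ n → a * n < k * b →
  (a ∸ δ) * n < k * (b ∸ δ)
a*n<k*b⇒[a∸δ]*n<k*[b∸δ] {a} {b} {k} {n} {δ} δ≤a δ≤b k≤n an<kb =
  +-cancelʳ-< (δ * n) ((a ∸ δ) * n) (k * (b ∸ δ)) (begin-strict
  (a ∸ δ) * n + δ * n      ≡⟨ *-distribʳ-+ n (a ∸ δ) δ ⟨
  (a ∸ δ + δ) * n          ≡⟨ cong (_* n) (m∸n+n≡m δ≤a) ⟩
  a * n                    <⟨ an<kb ⟩
  k * b                    ≡⟨ cong (k *_) (m∸n+n≡m δ≤b) ⟨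
  k * (b ∸ δ + δ)          ≡⟨ *-distribˡ-+ k (b ∸ δ) δ ⟩
  k * (b ∸ δ) + k * δ      ≤⟨ +-monoʳ-≤ (k * (b ∸ δ)) (≤-trans (*-monoˡ-≤ δ k≤n) (≤-reflexive (*-comm n δ))) ⟩
  k * (b ∸ δ) + δ * n      ∎)
  where open ≤-Reasoning

theorem118 : ∀ (n : ℕ) → 4 ≤ n → ∀ (T : Tree) → IsMinD n T →
    ∀ (δ cmax : ℕ) → IsMinColless n δ → IsMaxColless n cmax →
    NormCollessBelow n (colless T) δ cmax
theorem118 n@(suc (suc m)) (s≤s (s≤s 2≤m)) T minD δ cmax
           (_ , δ-minimal) ((Tₘ , leaves-Tₘ , colless-Tₘ) , cmax-maximal) =
  a*n<k*b⇒[a∸δ]*n<k*[b∸δ] (δ-minimal T (proj₁ minD)) (subst (δ ≤_) colless-Tₘ (δ-minimal Tₘ leaves-Tₘ))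
    (≤-trans (2*n≤2^n L) (2^⌊log₂n⌋≤n n)) (begin-strict
      colless T * n                           <⟨ minD⇒colless*n<⌊log₂n⌋*[m*[1+m]] {m} {T} 2≤m minD ⟩
      L * (m * suc m)                         ≡⟨ cong (L *_) (2*colless-caterpillar m) ⟨
      L * (2 * colless (caterpillar (suc m))) ≤⟨ *-monoʳ-≤ L (*-monoʳ-≤ 2 caterpillar≤cmax) ⟩
      L * (2 * cmax)                          ≡⟨ *-assoc L 2 cmax ⟨
      L * 2 * cmax                            ≡⟨ cong (_* cmax) (*-comm L 2) ⟩
      2 * L * cmax                            ∎)
  where
  open ≤-Reasoning
  L : ℕ
  L = ⌊log₂ n ⌋
  caterpillar≤cmax : colless (caterpillar (suc m)) ≤ cmax
  caterpillar≤cmax = cmax-maximal (caterpillar (suc m)) (leaves-caterpillar (suc m))
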